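{- For every $\epsilon>0$ and every positive integer $\sigma$ there exists a positive integer $r$ (depending only on $\epsilon$ and $\sigma$) such that the following holds. Let $\Sigma$ be an alphabet with $|\Sigma|=\sigma$, let $S$ be a finite multiset of length-$\ell$ strings over $\Sigma$, and let $S'=(s'_1,\dots,s'_r)$ be $r$ strings drawn from $S$ independently and uniformly at random (with replacement). Then $$E[d(S,c(S'))]\le (1+\epsilon)\, d(S,c(S)).$$
   Context: For length-$\ell$ strings $x,y$, $d(x,y)$ is their Hamming distance; for a multiset (or tuple) $T$ of length-$\ell$ strings and a string $x$, $d(T,x)=\sum_{t\in T} d(t,x)$. The consensus string $c(T)$ of a multiset/tuple $T$ of length-$\ell$ strings is the length-$\ell$ string whose $i$-th character is a most frequent character among the $i$-th characters of the strings of $T$ (counted with multiplicity), ties broken by choosing the lexicographically first such character. -}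

module Defs where

open import Data.Nat using (ℕ; zero; suc; _<ᵇ_; _^_; NonZero)
open import Data.Nat.Properties using (m^n≢0)
open import Data.Fin using (Fin; zero; suc)
open import Data.Fin.Properties using (_≟_)
open import Data.Vec using (Vec; []; _∷_; map; zipWith; lookup; tabulate; sum; count)
import Data.List as L
open import Data.Nat.ListAction using () renaming (sum to sumℕ)
open import Data.Bool using (if_then_else_)
open import Relation.Nullary using (does)
open import Data.Integer using (+_)
open import Data.Rational using (ℚ; _/_)

Str : ℕ → ℕ → Set
Str σ ℓ = Vec (Fin σ) ℓ

ham : ∀ {σ ℓ} → Str σ ℓ → Str σ ℓ → ℕ
ham x y = sum (zipWith (λ a b → if does (a ≟ b) then 0 else 1) x y)

-- d(T,x) = Σ_{t ∈ T} d(t,x), T a tuple/multiset given as a vector (with multiplicity)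
distT : ∀ {σ ℓ m} → Vec (Str σ ℓ) m → Str σ ℓ → ℕ
distT T x = sum (map (λ t → ham t x) T)

occ : ∀ {σ m} → Fin σ → Vec (Fin σ) m → ℕ
occ a col = count (a ≟_) col

-- lexicographically first most frequent character: scan the alphabet in increasing
-- order, replacing the current best only on a strict improvement.
mode : ∀ {σ m} → {{NonZero σ}} → Vec (Fin σ) m → Fin σ
mode {suc k} col =
  L.foldl (λ best a → if occ best col <ᵇ occ a col then a else best) zero (L.allFin (suc k))

consensus : ∀ {σ ℓ m} → {{NonZero σ}} → Vec (Str σ ℓ) m → Str σ ℓ
consensus T = tabulate (λ i → mode (map (λ t → lookup t i) T))

allTuples : (r n : ℕ) → L.List (Vec (Fin n) r)
allTuples zero n = [] L.∷ L.[]
allTuples (suc r) n = L.concatMap (λ v → L.map (λ i → i ∷ v) (L.allFin n)) (allTuples r n)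

-- E[d(S, c(S'))] where S' = (S_{i_1},…,S_{i_r}) with i_1,…,i_r independent uniform:
-- the average over all n^r index tuples.
expectedDist : ∀ {σ ℓ m} → {{NonZero σ}} → (r : ℕ) → Vec (Str σ ℓ) (suc m) → ℚ
expectedDist {m = m} r S =
  _/_ (+ sumℕ (L.map (λ idx → distT S (consensus (map (lookup S) idx))) (allTuples r (suc m))))
    (suc m ^ r) {{m^n≢0 (suc m) r}}

module Submission where

-- Both sides of the inequality split into a sum over columns, so it suffices to bound a
-- single column col of n letters with mode b.  Writing c a for the number of occurrences
-- of a in col, the cost of a letter a is the number n ∸ c a of entries differing from a.
-- If the sample's mode is a, its cost exceeds that of b by c b ∸ c a, and a "beats" b in
-- the sample: it occurs at least once and at least as often as b.  Hence, with K the
-- denominator of ε (so that 1 + 1/K ≤ 1 + ε),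
--   K · E[cost (mode sample)] ≤ (K + 1) · cost b
-- follows once K · (c b ∸ c a) · Pr[a beats b] ≤ c a for every letter a ≠ b.  This is clear
-- when K · (c b ∸ c a) ≤ c a.  For a rare letter we bound Pr[a beats b] by exponential
-- tilting: giving each sampled letter the weight u², v² or uv (u = v + 1) according to
-- whether it is a, b or another letter, every sample in which a beats b has weight at least
-- (uv)^r, while the sum over all samples of (number of a's) · weight has a closed form
-- in terms of the letter counts of the column.  For r large
-- enough, depending only on σ and K, this yields the per-letter bound.

open import Defs

module Development where
  open import Data.Nat hiding (_≟_)
  open import Data.Nat.Properties hiding (_≟_)
  open import Data.Nat.Tactic.RingSolver using (solve-∀)
  open import Data.Nat.ListAction using () renaming (sum to sumℕ)
  open import Data.Nat.ListAction.Properties using (sum-++)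
  open import Data.Fin using (Fin; zero; suc)
  open import Data.Fin.Properties using (_≟_)
  open import Data.Vec using (Vec; []; _∷_; map; lookup; sum; head; tail)
  open import Data.Vec.Properties using (map-cong; map-∘; lookup-map; tabulate-cong)
  import Data.List as L
  import Data.List.Properties as LP
  open import Data.List.Relation.Unary.All as All using (All; []; _∷_)
  open import Data.List.Membership.Propositional.Properties using (∈-allFin)
  open import Data.Bool using (Bool; true; false; if_then_else_; T; _∧_)
  open import Relation.Nullary using (does; ¬_; yes; no)
  open import Relation.Binary.PropositionalEquality
  open import Data.Empty using (⊥; ⊥-elim)
  open import Data.Product using (_×_; _,_; proj₂)
  open import Function using (_∘_; id)

  ∑ : {A : Set} → (A → ℕ) → L.List A → ℕ
  ∑ f xs = sumℕ (L.map f xs)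

  ∑-cong : ∀ {A : Set} {f g : A → ℕ} → (∀ x → f x ≡ g x) → ∀ xs → ∑ f xs ≡ ∑ g xs
  ∑-cong h L.[] = refl
  ∑-cong h (x L.∷ xs) = cong₂ _+_ (h x) (∑-cong h xs)

  ∑-mono : ∀ {A : Set} {f g : A → ℕ} → (∀ x → f x ≤ g x) → ∀ xs → ∑ f xs ≤ ∑ g xs
  ∑-mono h L.[] = z≤n
  ∑-mono h (x L.∷ xs) = +-mono-≤ (h x) (∑-mono h xs)

  ∑-zero : ∀ {A : Set} {f : A → ℕ} → (∀ x → f x ≡ 0) → ∀ xs → ∑ f xs ≡ 0
  ∑-zero h L.[] = refl
  ∑-zero h (x L.∷ xs) rewrite h x = ∑-zero h xs

  ∑-+ : ∀ {A : Set} (f g : A → ℕ) xs → ∑ (λ x → f x + g x) xs ≡ ∑ f xs + ∑ g xs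
  ∑-+ f g L.[] = refl
  ∑-+ f g (x L.∷ xs) rewrite ∑-+ f g xs = shuffle (f x) (g x) (∑ f xs) (∑ g xs)
    where
    shuffle : ∀ a b c d → a + b + (c + d) ≡ a + c + (b + d)
    shuffle = solve-∀

  ∑-*ˡ : ∀ {A : Set} c (f : A → ℕ) xs → ∑ (λ x → c * f x) xs ≡ c * ∑ f xs
  ∑-*ˡ c f L.[] = sym (*-zeroʳ c)
  ∑-*ˡ c f (x L.∷ xs) rewrite ∑-*ˡ c f xs = sym (*-distribˡ-+ c (f x) (∑ f xs))

  ∑-*ʳ : ∀ {A : Set} c (f : A → ℕ) xs → ∑ (λ x → f x * c) xs ≡ ∑ f xs * c
  ∑-*ʳ c f xs = trans (∑-cong (λ x → *-comm (f x) c) xs) (trans (∑-*ˡ c f xs) (*-comm c _))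

  ∑-swap : ∀ {A B : Set} (h : A → B → ℕ) xs ys →
    ∑ (λ x → ∑ (h x) ys) xs ≡ ∑ (λ y → ∑ (λ x → h x y) xs) ys
  ∑-swap h L.[] ys = sym (∑-zero (λ _ → refl) ys)
  ∑-swap h (x L.∷ xs) ys rewrite ∑-swap h xs ys = sym (∑-+ (h x) (λ y → ∑ (λ x → h x y) xs) ys)

  ∑-map : ∀ {A B : Set} (f : B → ℕ) (g : A → B) xs → ∑ f (L.map g xs) ≡ ∑ (f ∘ g) xs
  ∑-map f g xs = cong sumℕ (sym (LP.map-∘ xs))

  ∑-concatMap : ∀ {A B : Set} (f : B → ℕ) (h : A → L.List B) xs →
    ∑ f (L.concatMap h xs) ≡ ∑ (λ x → ∑ f (h x)) xs
  ∑-concatMap f h L.[] = refl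
  ∑-concatMap f h (x L.∷ xs) =
    trans (trans (cong sumℕ (LP.map-++ f (h x) (L.concatMap h xs))) (sum-++ (L.map f (h x)) _))
          (cong (∑ f (h x) +_) (∑-concatMap f h xs))

  ∑-allFin : ∀ {n} (G : Fin n → ℕ) → ∑ G (L.allFin n) ≡ sumℕ (L.tabulate G)
  ∑-allFin G = cong sumℕ (LP.map-tabulate id G)

  ∑-positions : ∀ {X : Set} {n} (f : X → ℕ) (col : Vec X n) →
    ∑ (λ i → f (lookup col i)) (L.allFin n) ≡ sum (map f col)
  ∑-positions f col = trans (∑-allFin (λ i → f (lookup col i))) (go col)
    where
    go : ∀ {n} (col : Vec _ n) → sumℕ (L.tabulate (λ i → f (lookup col i))) ≡ sum (map f col)
    go [] = refl
    go (x ∷ col) = cong (f x +_) (go col)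

  #allFin : ∀ n → ∑ (λ _ → 1) (L.allFin n) ≡ n
  #allFin n = trans (∑-allFin {n} (λ _ → 1)) (go n)
    where
    go : ∀ n → sumℕ (L.tabulate {n = n} (λ _ → 1)) ≡ n
    go zero = refl
    go (suc n) = cong suc (go n)

  -- Sums over all index tuples (the sample space of r draws from n strings)

  ∑-tuples-suc : ∀ r n (f : Vec (Fin n) (suc r) → ℕ) →
    ∑ f (allTuples (suc r) n) ≡ ∑ (λ v → ∑ (λ i → f (i ∷ v)) (L.allFin n)) (allTuples r n)
  ∑-tuples-suc r n f = trans (∑-concatMap f _ (allTuples r n))
    (∑-cong (λ v → ∑-map f (λ i → i ∷ v) (L.allFin n)) (allTuples r n))

  #tuples : ∀ r n → ∑ (λ _ → 1) (allTuples r n) ≡ n ^ r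
  #tuples zero n = refl
  #tuples (suc r) n = begin
    ∑ (λ _ → 1) (allTuples (suc r) n)  ≡⟨ ∑-tuples-suc r n (λ _ → 1) ⟩
    ∑ (λ _ → ∑ (λ _ → 1) (L.allFin n)) (allTuples r n)  ≡⟨ ∑-cong (λ _ → trans (#allFin n) (sym (*-identityʳ n))) (allTuples r n) ⟩
    ∑ (λ _ → n * 1) (allTuples r n)  ≡⟨ ∑-*ˡ n (λ _ → 1) (allTuples r n) ⟩
    n * ∑ (λ _ → 1) (allTuples r n)  ≡⟨ cong (n *_) (#tuples r n) ⟩
    n * n ^ r ∎
    where open ≡-Reasoning

  ∑-tuples-const : ∀ r n C → ∑ (λ _ → C) (allTuples r n) ≡ C * n ^ r
  ∑-tuples-const r n C = trans (∑-cong (λ _ → sym (*-identityʳ C)) (allTuples r n))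
    (trans (∑-*ˡ C (λ _ → 1) (allTuples r n)) (cong (C *_) (#tuples r n)))

  indicator : Bool → ℕ
  indicator true = 1
  indicator false = 0

  -- [a = t], and the Hamming summand [a ≠ t] as written in Defs.ham.
  same differ : ∀ {σ} → Fin σ → Fin σ → ℕ
  same a t = indicator (does (a ≟ t))
  differ a t = if does (a ≟ t) then 0 else 1

  does-sym : ∀ {n} (a b : Fin n) → does (a ≟ b) ≡ does (b ≟ a)
  does-sym zero zero = refl
  does-sym zero (suc b) = refl
  does-sym (suc a) zero = refl
  does-sym (suc a) (suc b) = does-sym a b

  does-refl : ∀ {n} (a : Fin n) → does (a ≟ a) ≡ true
  does-refl zero = refl
  does-refl (suc a) = does-refl a

  does-true : ∀ {n} (a t : Fin n) → does (a ≟ t) ≡ true → a ≡ t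
  does-true a t e with a ≟ t
  ... | yes a≡t = a≡t

  occ-cons : ∀ {σ m} (a t : Fin σ) (s : Vec (Fin σ) m) → occ a (t ∷ s) ≡ same a t + occ a s
  occ-cons a t s with does (a ≟ t)
  ... | true = refl
  ... | false = refl

  occ-head : ∀ {σ k} (t : Fin σ) (s : Vec (Fin σ) k) → 1 ≤ occ t (t ∷ s)
  occ-head t s rewrite occ-cons t t s | does-refl t = s≤s z≤n

  cost : ∀ {σ m} → Vec (Fin σ) m → Fin σ → ℕ
  cost col a = sum (map (λ h → differ h a) col)

  cost+occ : ∀ {σ m} (col : Vec (Fin σ) m) a → cost col a + occ a col ≡ m
  cost+occ [] a = refl
  cost+occ (h ∷ col) a rewrite occ-cons a h col | does-sym h a with does (a ≟ h)
  ... | true = trans (+-suc (cost col a) (occ a col)) (cong suc (cost+occ col a))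
  ... | false = cong suc (cost+occ col a)

  -- The mode is a most frequent letter: the fold defining it keeps a running maximum.
  module RunningMax {σ m} (s : Vec (Fin σ) m) where
    better : Fin σ → Fin σ → Fin σ
    better best a = if occ best s <ᵇ occ a s then a else best

    better-max : ∀ z x → (occ z s ≤ occ (better z x) s) × (occ x s ≤ occ (better z x) s)
    better-max z x with occ z s <ᵇ occ x s in eq
    ... | true = <⇒≤ (<ᵇ⇒< (occ z s) (occ x s) (subst T (sym eq) _)) , ≤-refl
    ... | false = ≤-refl , ≮⇒≥ (λ lt → subst T eq (<⇒<ᵇ lt))

    fold-max : ∀ z xs → (occ z s ≤ occ (L.foldl better z xs) s)
                       × All (λ x → occ x s ≤ occ (L.foldl better z xs) s) xs
    fold-max z L.[] = ≤-refl , []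
    fold-max z (x L.∷ xs) =
      let (z≤ , x≤) = better-max z x
          (y≤ , xs≤) = fold-max (better z x) xs
      in ≤-trans z≤ y≤ , ≤-trans x≤ y≤ ∷ xs≤

  mode-max : ∀ {σ m} {{_ : NonZero σ}} (s : Vec (Fin σ) m) (a : Fin σ) → occ a s ≤ occ (mode s) s
  mode-max {suc k} s a =
    All.lookup (proj₂ (RunningMax.fold-max s zero (L.allFin (suc k)))) (∈-allFin a)

  ∑-delta : ∀ {σ} (f : Fin σ → ℕ) (t : Fin σ) → ∑ (λ a → f a * same a t) (L.allFin σ) ≡ f t
  ∑-delta f t = trans (∑-allFin (λ a → f a * same a t)) (go f t)
    where
    off-diagonal : ∀ {k} (f : Fin (suc k) → ℕ) → sumℕ (L.tabulate {n = k} (λ i → f (suc i) * same (suc i) zero)) ≡ 0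
    off-diagonal {zero} f = refl
    off-diagonal {suc k} f = cong₂ _+_ (*-zeroʳ (f (suc zero))) (off-diagonal (λ i → f (suc i)))
    go : ∀ {σ} (f : Fin σ → ℕ) (t : Fin σ) → sumℕ (L.tabulate (λ a → f a * same a t)) ≡ f t
    go {suc k} f zero = trans (cong₂ _+_ (*-identityʳ (f zero)) (off-diagonal f)) (+-identityʳ (f zero))
    go {suc k} f (suc t) = cong₂ _+_ (*-zeroʳ (f zero)) (go (λ i → f (suc i)) t)

  term≤∑ : ∀ {σ} (f : Fin σ → ℕ) (a : Fin σ) → f a ≤ ∑ f (L.allFin σ)
  term≤∑ f a = begin
    f a  ≡⟨ sym (∑-delta f a) ⟩
    ∑ (λ x → f x * same x a) (L.allFin _)  ≤⟨ ∑-mono (λ x → *-monoʳ-≤ (f x) (same≤1 x)) (L.allFin _) ⟩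
    ∑ (λ x → f x * 1) (L.allFin _)  ≡⟨ ∑-cong (λ x → *-identityʳ (f x)) (L.allFin _) ⟩
    ∑ f (L.allFin _) ∎
    where
    open ≤-Reasoning
    same≤1 : ∀ x → same x a ≤ 1
    same≤1 x with does (x ≟ a)
    ... | true = ≤-refl
    ... | false = z≤n

  ∑-occ : ∀ {σ m} (f : Fin σ → ℕ) (s : Vec (Fin σ) m) → ∑ (λ a → f a * occ a s) (L.allFin σ) ≡ sum (map f s)
  ∑-occ {σ} f [] = ∑-zero (λ a → *-zeroʳ (f a)) (L.allFin σ)
  ∑-occ {σ} f (t ∷ s) = begin
    ∑ (λ a → f a * occ a (t ∷ s)) (L.allFin σ)
      ≡⟨ ∑-cong (λ a → trans (cong (f a *_) (occ-cons a t s)) (*-distribˡ-+ (f a) (same a t) (occ a s))) (L.allFin σ) ⟩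
    ∑ (λ a → f a * same a t + f a * occ a s) (L.allFin σ)  ≡⟨ ∑-+ _ _ (L.allFin σ) ⟩
    ∑ (λ a → f a * same a t) (L.allFin σ) + ∑ (λ a → f a * occ a s) (L.allFin σ)  ≡⟨ cong₂ _+_ (∑-delta f t) (∑-occ f s) ⟩
    f t + sum (map f s) ∎
    where open ≡-Reasoning

  pigeonhole : ∀ {σ m} {{_ : NonZero σ}} (col : Vec (Fin σ) m) → m ≤ σ * occ (mode col) col
  pigeonhole {σ} {m} col = begin
    m  ≡⟨ sym (ones col) ⟩
    sum (map (λ _ → 1) col)  ≡⟨ sym (∑-occ (λ _ → 1) col) ⟩
    ∑ (λ a → 1 * occ a col) (L.allFin σ)  ≤⟨ ∑-mono (λ a → ≤-trans (≤-reflexive (*-identityˡ (occ a col))) (≤-trans (mode-max col a) (≤-reflexive (sym (*-identityʳ cb))))) (L.allFin σ) ⟩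
    ∑ (λ a → cb * 1) (L.allFin σ)  ≡⟨ ∑-*ˡ cb (λ _ → 1) (L.allFin σ) ⟩
    cb * ∑ (λ _ → 1) (L.allFin σ)  ≡⟨ cong (cb *_) (#allFin σ) ⟩
    cb * σ  ≡⟨ *-comm cb σ ⟩
    σ * cb ∎
    where
    open ≤-Reasoning
    cb : ℕ
    cb = occ (mode col) col
    ones : ∀ {X : Set} {m} (c : Vec X m) → sum (map (λ _ → 1) c) ≡ m
    ones [] = refl
    ones (_ ∷ c) = cong suc (ones c)

  -- One column: reducing the expected cost of the sample's mode to single letters

  shift-≤ : ∀ p q r s → p + q ≡ r + s → q ≤ s → p ≤ r + (s ∸ q)
  shift-≤ p q r s e q≤s = ≤-reflexive (+-cancelʳ-≡ q p (r + (s ∸ q))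
    (trans e (trans (cong (r +_) (sym (m∸n+n≡m q≤s))) (sym (+-assoc r (s ∸ q) q)))))

  T⇒≡true : ∀ {x} → T x → x ≡ true
  T⇒≡true {true} _ = refl

  select : ∀ {X : Set} {n r} → Vec X n → Vec (Fin n) r → Vec X r
  select xs idx = map (lookup xs) idx

  beats : ∀ {σ r} → Fin σ → Fin σ → Vec (Fin σ) r → Bool
  beats a b s = (occ b s ≤ᵇ occ a s) ∧ (1 ≤ᵇ occ a s)

  module Column {σ m} {{_ : NonZero σ}} (col : Vec (Fin σ) (suc m)) where
    n : ℕ
    n = suc m

    c : Fin σ → ℕ
    c a = occ a col

    b : Fin σ
    b = mode col

    gap : Fin σ → ℕ
    gap a = c b ∸ c a

    sample : ∀ {r} → Vec (Fin n) r → Vec (Fin σ) r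
    sample = select col

    wins : ℕ → Fin σ → ℕ
    wins r a = ∑ (λ idx → indicator (beats a b (sample idx))) (allTuples r n)

    -- n ^ r times the expected cost of the sample's mode
    totalCost : ℕ → ℕ
    totalCost r = ∑ (λ idx → cost col (mode (sample idx))) (allTuples r n)

    wins≤ : ∀ r a → wins r a ≤ n ^ r
    wins≤ r a = ≤-trans (∑-mono (λ idx → indicator≤1 (beats a b (sample idx))) (allTuples r n))
                        (≤-reflexive (#tuples r n))
      where
      indicator≤1 : ∀ x → indicator x ≤ 1
      indicator≤1 true = ≤-refl
      indicator≤1 false = z≤n

    mode-beats : ∀ {k} (s : Vec (Fin σ) (suc k)) → beats (mode s) b s ≡ true
    mode-beats (t ∷ s) rewrite T⇒≡true (≤⇒≤ᵇ (mode-max (t ∷ s) b))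
                             | T⇒≡true (≤⇒≤ᵇ (≤-trans (occ-head t s) (mode-max (t ∷ s) t))) = refl

    -- Choosing the letter a costs gap a more than choosing b, and then a beats b.
    cost-mode≤ : ∀ {k} (s : Vec (Fin σ) (suc k)) →
      cost col (mode s) ≤ cost col b + ∑ (λ a → gap a * indicator (beats a b s)) (L.allFin σ)
    cost-mode≤ s = begin
      cost col z  ≤⟨ shift-≤ (cost col z) (c z) (cost col b) (c b)
                       (trans (cost+occ col z) (sym (cost+occ col b))) (mode-max col z) ⟩
      cost col b + gap z  ≡⟨ cong (cost col b +_) (sym (trans (cong (λ x → gap z * indicator x) (mode-beats s)) (*-identityʳ (gap z)))) ⟩
      cost col b + gap z * indicator (beats z b s)  ≤⟨ +-monoʳ-≤ (cost col b) (term≤∑ (λ a → gap a * indicator (beats a b s)) z) ⟩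
      cost col b + ∑ (λ a → gap a * indicator (beats a b s)) (L.allFin σ) ∎
      where
      open ≤-Reasoning
      z : Fin σ
      z = mode s

    -- Averaging cost-mode≤ over all samples: per-letter bounds K · gap a · Pr[a beats b] ≤ [a ≠ b] · c a
    -- add up to K · E[cost] ≤ (K + 1) · cost b, because Σ_a [a ≠ b] · c a = cost col b.
    reduce-to-letters : ∀ K k → (∀ a → K * (gap a * wins (suc k) a) ≤ differ a b * c a * n ^ suc k) →
      K * totalCost (suc k) ≤ suc K * n ^ suc k * cost col b
    reduce-to-letters K k per-letter = begin
      K * totalCost (suc k)  ≤⟨ *-monoʳ-≤ K (∑-mono (λ idx → cost-mode≤ (sample idx)) tups) ⟩
      K * ∑ (λ idx → cost col b + excess idx) tups  ≡⟨ cong (K *_) (∑-+ (λ _ → cost col b) excess tups) ⟩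
      K * (∑ (λ _ → cost col b) tups + ∑ excess tups)  ≡⟨ cong₂ (λ x y → K * (x + y)) (∑-tuples-const (suc k) n (cost col b)) excess-by-letter ⟩
      K * (cost col b * N + ∑ (λ a → gap a * wins (suc k) a) (L.allFin σ))  ≡⟨ *-distribˡ-+ K _ _ ∙ cong (K * (cost col b * N) +_) (sym (∑-*ˡ K _ (L.allFin σ))) ⟩
      K * (cost col b * N) + ∑ (λ a → K * (gap a * wins (suc k) a)) (L.allFin σ)  ≤⟨ +-monoʳ-≤ (K * (cost col b * N)) (∑-mono per-letter (L.allFin σ)) ⟩
      K * (cost col b * N) + ∑ (λ a → differ a b * c a * N) (L.allFin σ)  ≡⟨ cong (K * (cost col b * N) +_) (trans (∑-*ʳ N (λ a → differ a b * c a) (L.allFin σ)) (cong (_* N) (∑-occ (λ a → differ a b) col))) ⟩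
      K * (cost col b * N) + cost col b * N  ≡⟨ collect K (cost col b) N ⟩
      suc K * N * cost col b ∎
      where
      open ≤-Reasoning
      _∙_ : ∀ {x y z : ℕ} → x ≡ y → y ≡ z → x ≡ z
      _∙_ = trans
      tups : L.List (Vec (Fin n) (suc k))
      tups = allTuples (suc k) n
      N : ℕ
      N = n ^ suc k
      excess : Vec (Fin n) (suc k) → ℕ
      excess idx = ∑ (λ a → gap a * indicator (beats a b (sample idx))) (L.allFin σ)
      excess-by-letter : ∑ excess tups ≡ ∑ (λ a → gap a * wins (suc k) a) (L.allFin σ)
      excess-by-letter = ∑-swap (λ idx a → gap a * indicator (beats a b (sample idx))) tups (L.allFin σ)
        ∙ ∑-cong (λ a → ∑-*ˡ (gap a) (λ idx → indicator (beats a b (sample idx))) tups) (L.allFin σ)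
      collect : ∀ K C N → K * (C * N) + C * N ≡ suc K * N * C
      collect = solve-∀

  -- Exponential tilting

  module Tilting {σ} (a b : Fin σ) (a≢b : ¬ a ≡ b) (v : ℕ) where
    u : ℕ
    u = suc v

    weightOf : Bool → Bool → ℕ
    weightOf true _ = u * u
    weightOf false true = v * v
    weightOf false false = u * v

    weight : Fin σ → ℕ
    weight t = weightOf (does (a ≟ t)) (does (b ≟ t))

    Wt : ∀ {r} → Vec (Fin σ) r → ℕ
    Wt [] = 1
    Wt (t ∷ s) = weight t * Wt s

    not-both : ∀ t → does (a ≟ t) ≡ true → does (b ≟ t) ≡ true → ⊥
    not-both t a≡t b≡t = a≢b (trans (does-true a t a≡t) (sym (does-true b t b≡t)))

    -- Each letter's weight is uv, corrected by a factor u/v if it is a and v/u if it is b.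
    balance : ∀ p q → (p ≡ true → q ≡ true → ⊥) →
      weightOf p q * (v ^ indicator p * u ^ indicator q) ≡ u * v * (u ^ indicator p * v ^ indicator q)
    balance true true not-both = ⊥-elim (not-both refl refl)
    balance true false _ = identity v
      where
      identity : ∀ v → suc v * suc v * (v * 1 * 1) ≡ suc v * v * (suc v * 1 * 1)
      identity = solve-∀
    balance false true _ = identity v
      where
      identity : ∀ v → v * v * (1 * (suc v * 1)) ≡ suc v * v * (1 * (v * 1))
      identity = solve-∀
    balance false false _ = refl

    pow-occ : ∀ {r} x c t (s : Vec (Fin σ) r) → x ^ occ c (t ∷ s) ≡ x ^ same c t * x ^ occ c s
    pow-occ x c t s = trans (cong (x ^_) (occ-cons c t s)) (^-distribˡ-+-* x (same c t) (occ c s))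

    Wt-closed : ∀ {r} (s : Vec (Fin σ) r) →
      Wt s * (v ^ occ a s * u ^ occ b s) ≡ (u * v) ^ r * (u ^ occ a s * v ^ occ b s)
    Wt-closed [] = refl
    Wt-closed {suc r} (t ∷ s) = begin
      weight t * Wt s * (v ^ occ a (t ∷ s) * u ^ occ b (t ∷ s))
        ≡⟨ cong₂ (λ p q → weight t * Wt s * (p * q)) (pow-occ v a t s) (pow-occ u b t s) ⟩
      weight t * Wt s * (v ^ ia * v ^ occ a s * (u ^ ib * u ^ occ b s))
        ≡⟨ regroupˡ (weight t) (Wt s) (v ^ ia) (v ^ occ a s) (u ^ ib) (u ^ occ b s) ⟩
      weight t * (v ^ ia * u ^ ib) * (Wt s * (v ^ occ a s * u ^ occ b s))
        ≡⟨ cong₂ _*_ (balance (does (a ≟ t)) (does (b ≟ t)) (not-both t)) (Wt-closed s) ⟩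
      u * v * (u ^ ia * v ^ ib) * ((u * v) ^ r * (u ^ occ a s * v ^ occ b s))
        ≡⟨ regroupʳ (u * v) (u ^ ia) (v ^ ib) ((u * v) ^ r) (u ^ occ a s) (v ^ occ b s) ⟩
      u * v * (u * v) ^ r * (u ^ ia * u ^ occ a s * (v ^ ib * v ^ occ b s))
        ≡⟨ sym (cong₂ (λ p q → u * v * (u * v) ^ r * (p * q)) (pow-occ u a t s) (pow-occ v b t s)) ⟩
      u * v * (u * v) ^ r * (u ^ occ a (t ∷ s) * v ^ occ b (t ∷ s)) ∎
      where
      open ≡-Reasoning
      ia ib : ℕ
      ia = same a t
      ib = same b t
      regroupˡ : ∀ G W p q r s → G * W * (p * q * (r * s)) ≡ G * (p * r) * (W * (q * s))
      regroupˡ = solve-∀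
      regroupʳ : ∀ U p q R r s → U * (p * q) * (R * (r * s)) ≡ U * R * (p * r * (q * s))
      regroupʳ = solve-∀

    swap-powers : ∀ x y → y ≤ x → v ^ x * u ^ y ≤ u ^ x * v ^ y
    swap-powers x y y≤x = begin
      v ^ x * u ^ y  ≡⟨ cong (λ z → v ^ z * u ^ y) (sym x≡y+d) ⟩
      v ^ (y + d) * u ^ y  ≡⟨ cong (_* u ^ y) (^-distribˡ-+-* v y d) ⟩
      v ^ y * v ^ d * u ^ y  ≡⟨ rotate (v ^ y) (v ^ d) (u ^ y) ⟩
      v ^ d * (u ^ y * v ^ y)  ≤⟨ *-monoˡ-≤ (u ^ y * v ^ y) (^-monoˡ-≤ d (n≤1+n v)) ⟩
      u ^ d * (u ^ y * v ^ y)  ≡⟨ rotate′ (u ^ d) (u ^ y) (v ^ y) ⟩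
      u ^ y * u ^ d * v ^ y  ≡⟨ cong (_* v ^ y) (sym (^-distribˡ-+-* u y d)) ⟩
      u ^ (y + d) * v ^ y  ≡⟨ cong (λ z → u ^ z * v ^ y) x≡y+d ⟩
      u ^ x * v ^ y ∎
      where
      open ≤-Reasoning
      d : ℕ
      d = x ∸ y
      x≡y+d : y + d ≡ x
      x≡y+d = m+[n∸m]≡n y≤x
      rotate : ∀ p q r → p * q * r ≡ q * (r * p)
      rotate = solve-∀
      rotate′ : ∀ p q r → p * (q * r) ≡ q * p * r
      rotate′ = solve-∀

    Wt-large : ∀ {r} {{_ : NonZero v}} (s : Vec (Fin σ) r) → occ b s ≤ occ a s → (u * v) ^ r ≤ Wt s
    Wt-large {r} s b≤a = *-cancelʳ-≤ ((u * v) ^ r) (Wt s) R {{R≢0}} (begin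
      (u * v) ^ r * R  ≡⟨ sym (Wt-closed s) ⟩
      Wt s * (v ^ occ a s * u ^ occ b s)  ≤⟨ *-monoʳ-≤ (Wt s) (swap-powers (occ a s) (occ b s) b≤a) ⟩
      Wt s * R ∎)
      where
      open ≤-Reasoning
      R : ℕ
      R = u ^ occ a s * v ^ occ b s
      R≢0 : NonZero R
      R≢0 = m*n≢0 (u ^ occ a s) (v ^ occ b s) {{m^n≢0 u (occ a s)}} {{m^n≢0 v (occ b s)}}

    beats-weight : ∀ {r} {{_ : NonZero v}} (s : Vec (Fin σ) r) →
      indicator (beats a b s) * (u * v) ^ r ≤ occ a s * Wt s
    beats-weight {r} s with occ b s ≤ᵇ occ a s in b≤a | 1 ≤ᵇ occ a s in a≥1
    ... | true | true = begin
      1 * (u * v) ^ r  ≡⟨ *-identityˡ _ ⟩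
      (u * v) ^ r  ≤⟨ Wt-large s (≤ᵇ⇒≤ _ _ (subst T (sym b≤a) _)) ⟩
      Wt s  ≡⟨ sym (*-identityˡ (Wt s)) ⟩
      1 * Wt s  ≤⟨ *-monoˡ-≤ (Wt s) (≤ᵇ⇒≤ 1 (occ a s) (subst T (sym a≥1) _)) ⟩
      occ a s * Wt s ∎
      where open ≤-Reasoning
    ... | true | false = z≤n
    ... | false | _ = z≤n

    module Moments {n} (col : Vec (Fin σ) n) where
      B A : ℕ
      B = sum (map weight col)
      A = sum (map (λ t → same a t * weight t) col)

      mass : ∀ r → ∑ (λ idx → Wt (select col idx)) (allTuples r n) ≡ B ^ r
      mass zero = refl
      mass (suc r) = begin
        ∑ (λ idx → Wt (select col idx)) (allTuples (suc r) n)  ≡⟨ ∑-tuples-suc r n (λ idx → Wt (select col idx)) ⟩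
        ∑ (λ w → ∑ (λ i → weight (lookup col i) * Wt (select col w)) (L.allFin n)) (allTuples r n)
          ≡⟨ ∑-cong (λ w → trans (∑-*ʳ (Wt (select col w)) (λ i → weight (lookup col i)) (L.allFin n))
                                 (cong (_* Wt (select col w)) (∑-positions weight col))) (allTuples r n) ⟩
        ∑ (λ w → B * Wt (select col w)) (allTuples r n)  ≡⟨ ∑-*ˡ B (λ w → Wt (select col w)) (allTuples r n) ⟩
        B * ∑ (λ w → Wt (select col w)) (allTuples r n)  ≡⟨ cong (B *_) (mass r) ⟩
        B * B ^ r ∎
        where open ≡-Reasoning

      moment : ℕ → ℕ
      moment r = ∑ (λ idx → occ a (select col idx) * Wt (select col idx)) (allTuples r n)

      moment-suc : ∀ r → moment (suc r) ≡ A * B ^ r + B * moment r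
      moment-suc r = begin
        moment (suc r)  ≡⟨ ∑-tuples-suc r n (λ idx → occ a (select col idx) * Wt (select col idx)) ⟩
        ∑ (λ w → ∑ (λ i → occ a (lookup col i ∷ select col w) * (weight (lookup col i) * Wt (select col w))) (L.allFin n)) (allTuples r n)
          ≡⟨ ∑-cong first-draw (allTuples r n) ⟩
        ∑ (λ w → A * Wt (select col w) + B * (occ a (select col w) * Wt (select col w))) (allTuples r n)
          ≡⟨ ∑-+ _ _ (allTuples r n) ⟩
        ∑ (λ w → A * Wt (select col w)) (allTuples r n) + ∑ (λ w → B * (occ a (select col w) * Wt (select col w))) (allTuples r n)
          ≡⟨ cong₂ _+_ (trans (∑-*ˡ A _ (allTuples r n)) (cong (A *_) (mass r))) (∑-*ˡ B _ (allTuples r n)) ⟩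
        A * B ^ r + B * moment r ∎
        where
        open ≡-Reasoning
        split : ∀ {k} t (s : Vec (Fin σ) k) →
          occ a (t ∷ s) * (weight t * Wt s) ≡ same a t * weight t * Wt s + weight t * (occ a s * Wt s)
        split t s rewrite occ-cons a t s = distribute (same a t) (occ a s) (weight t) (Wt s)
          where
          distribute : ∀ i o g w → (i + o) * (g * w) ≡ i * g * w + g * (o * w)
          distribute = solve-∀
        first-draw : ∀ w → ∑ (λ i → occ a (lookup col i ∷ select col w) * (weight (lookup col i) * Wt (select col w))) (L.allFin n)
                         ≡ A * Wt (select col w) + B * (occ a (select col w) * Wt (select col w))
        first-draw w = let s = select col w in begin
          ∑ (λ i → occ a (lookup col i ∷ s) * (weight (lookup col i) * Wt s)) (L.allFin n)
            ≡⟨ ∑-cong (λ i → split (lookup col i) s) (L.allFin n) ⟩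
          ∑ (λ i → same a (lookup col i) * weight (lookup col i) * Wt s + weight (lookup col i) * (occ a s * Wt s)) (L.allFin n)
            ≡⟨ ∑-+ _ _ (L.allFin n) ⟩
          ∑ (λ i → same a (lookup col i) * weight (lookup col i) * Wt s) (L.allFin n) + ∑ (λ i → weight (lookup col i) * (occ a s * Wt s)) (L.allFin n)
            ≡⟨ cong₂ _+_ (trans (∑-*ʳ (Wt s) _ (L.allFin n)) (cong (_* Wt s) (∑-positions (λ t → same a t * weight t) col)))
                         (trans (∑-*ʳ (occ a s * Wt s) _ (L.allFin n)) (cong (_* (occ a s * Wt s)) (∑-positions weight col))) ⟩
          A * Wt s + B * (occ a s * Wt s) ∎

      moment-closed : ∀ k → moment (suc k) ≡ suc k * A * B ^ k
      moment-closed zero = trans (moment-suc 0) (identity A B)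
        where
        identity : ∀ A B → A * 1 + B * 0 ≡ 1 * A * 1
        identity = solve-∀
      moment-closed (suc k) = trans (moment-suc (suc k))
        (trans (cong (λ x → A * (B * B ^ k) + B * x) (moment-closed k)) (identity A B (B ^ k) k))
        where
        identity : ∀ A B Bk k → A * (B * Bk) + B * (suc k * A * Bk) ≡ suc (suc k) * A * (B * Bk)
        identity = solve-∀

    A-closed : ∀ {n} (col : Vec (Fin σ) n) → Moments.A col ≡ u * u * occ a col
    A-closed [] = sym (*-zeroʳ (u * u))
    A-closed (t ∷ col) rewrite occ-cons a t col | A-closed col =
      trans (cong (_+ u * u * occ a col) (on-a (does (a ≟ t)) (does (b ≟ t))))
            (sym (*-distribˡ-+ (u * u) (same a t) (occ a col)))
      where
      on-a : ∀ p q → indicator p * weightOf p q ≡ u * u * indicator p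
      on-a true q = trans (+-identityʳ (u * u)) (sym (*-identityʳ (u * u)))
      on-a false q = sym (*-zeroʳ (u * u))

    B-closed : ∀ {n} (col : Vec (Fin σ) n) → Moments.B col + v * occ b col ≡ u * v * n + u * occ a col
    B-closed [] = trans (*-zeroʳ v) (sym (cong₂ _+_ (*-zeroʳ (u * v)) (*-zeroʳ u)))
    B-closed {suc n} (t ∷ col) rewrite occ-cons a t col | occ-cons b t col = begin
      weight t + Moments.B col + v * (same b t + occ b col)  ≡⟨ regroup (weight t) (Moments.B col) v (same b t) (occ b col) ⟩
      (weight t + v * same b t) + (Moments.B col + v * occ b col)  ≡⟨ cong₂ _+_ (letter p q (not-both t)) (B-closed col) ⟩
      (u * v + u * same a t) + (u * v * n + u * occ a col)  ≡⟨ regroup′ u v (same a t) n (occ a col) ⟩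
      u * v * suc n + u * (same a t + occ a col) ∎
      where
      open ≡-Reasoning
      p q : Bool
      p = does (a ≟ t)
      q = does (b ≟ t)
      regroup : ∀ G S v q o → G + S + v * (q + o) ≡ (G + v * q) + (S + v * o)
      regroup = solve-∀
      regroup′ : ∀ u v p n o → (u * v + u * p) + (u * v * n + u * o) ≡ u * v * suc n + u * (p + o)
      regroup′ = solve-∀
      -- u² = uv + u and v² + v = uv
      letter : ∀ p q → (p ≡ true → q ≡ true → ⊥) → weightOf p q + v * indicator q ≡ u * v + u * indicator p
      letter true true not-both = ⊥-elim (not-both refl refl)
      letter true false _ = identity v
        where
        identity : ∀ v → suc v * suc v + v * 0 ≡ suc v * v + suc v * 1
        identity = solve-∀
      letter false true _ = identity v
        where
        identity : ∀ v → v * v + v * 1 ≡ suc v * v + suc v * 0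
        identity = solve-∀
      letter false false _ = cong (u * v +_) (trans (*-zeroʳ v) (sym (*-zeroʳ u)))

  -- Arithmetic: an exponential eventually beats a polynomial factor

  ^-distribʳ-* : ∀ a b k → (a * b) ^ k ≡ a ^ k * b ^ k
  ^-distribʳ-* a b zero = refl
  ^-distribʳ-* a b (suc k) rewrite ^-distribʳ-* a b k = interchange a b (a ^ k) (b ^ k)
    where
    interchange : ∀ a b p q → a * b * (p * q) ≡ a * p * (b * q)
    interchange = solve-∀

  bernoulli : ∀ x k → x ^ k * (x + suc k) ≤ suc x ^ suc k
  bernoulli x zero = ≤-reflexive (identity x)
    where
    identity : ∀ x → 1 * (x + 1) ≡ suc x * 1
    identity = solve-∀
  bernoulli x (suc k) = begin
    x * x ^ k * (x + suc (suc k))  ≤⟨ m≤m+n _ _ ⟩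
    x * x ^ k * (x + suc (suc k)) + x ^ k * suc k  ≡⟨ identity x (x ^ k) k ⟩
    suc x * (x ^ k * (x + suc k))  ≤⟨ *-monoʳ-≤ (suc x) (bernoulli x k) ⟩
    suc x * suc x ^ suc k ∎
    where
    open ≤-Reasoning
    identity : ∀ x y k → x * y * (x + suc (suc k)) + y * suc k ≡ suc x * (y * (x + suc k))
    identity = solve-∀

  double-by-x : ∀ x → 1 ≤ x → 2 * x ^ x ≤ suc x ^ x
  double-by-x (suc x) _ = begin
    2 * (suc x * suc x ^ x)  ≡⟨ identity (suc x) (suc x ^ x) ⟩
    suc x ^ x * (suc x + suc x)  ≤⟨ bernoulli (suc x) x ⟩
    suc (suc x) ^ suc x ∎
    where
    open ≤-Reasoning
    identity : ∀ x y → 2 * (x * y) ≡ y * (x + x)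
    identity = solve-∀

  square≤pow2 : ∀ i → (4 + i) * (4 + i) ≤ 2 ^ (4 + i)
  square≤pow2 zero = ≤-refl
  square≤pow2 (suc i) = begin
    (5 + i) * (5 + i)  ≡⟨ expand i ⟩
    (4 + i) * (4 + i) + (9 + 2 * i)  ≤⟨ +-monoʳ-≤ ((4 + i) * (4 + i)) (≤-trans (m≤m+n (9 + 2 * i) (7 + 6 * i + i * i)) (≤-reflexive (complete i))) ⟩
    (4 + i) * (4 + i) + (4 + i) * (4 + i)  ≤⟨ +-mono-≤ (square≤pow2 i) (≤-trans (square≤pow2 i) (m≤m+n _ 0)) ⟩
    2 ^ (4 + i) + (2 ^ (4 + i) + 0) ∎
    where
    open ≤-Reasoning
    expand : ∀ i → (5 + i) * (5 + i) ≡ (4 + i) * (4 + i) + (9 + 2 * i)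
    expand = solve-∀
    complete : ∀ i → 9 + 2 * i + (7 + 6 * i + i * i) ≡ (4 + i) * (4 + i)
    complete = solve-∀

  -- An exponent large enough that a · (k + 1) · xᵏ ≤ (x + 1)ᵏ.
  exponentFor : ℕ → ℕ → ℕ
  exponentFor a x = x * (4 + a * suc x)

  -- With k = x j and j = 4 + a(x + 1):  a (k + 1) ≤ j² ≤ 2ʲ  and  2ʲ (xˣ)ʲ ≤ ((x + 1)ˣ)ʲ.
  exponential-wins : ∀ a x → 1 ≤ x →
    a * suc (exponentFor a x) * x ^ exponentFor a x ≤ suc x ^ exponentFor a x
  exponential-wins a x x≥1 = begin
    a * suc (x * j) * x ^ (x * j)  ≤⟨ *-monoˡ-≤ (x ^ (x * j)) factor≤2ʲ ⟩
    2 ^ j * x ^ (x * j)  ≡⟨ cong (2 ^ j *_) (sym (^-*-assoc x x j)) ⟩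
    2 ^ j * (x ^ x) ^ j  ≡⟨ sym (^-distribʳ-* 2 (x ^ x) j) ⟩
    (2 * x ^ x) ^ j  ≤⟨ ^-monoˡ-≤ j (double-by-x x x≥1) ⟩
    (suc x ^ x) ^ j  ≡⟨ ^-*-assoc (suc x) x j ⟩
    suc x ^ (x * j) ∎
    where
    open ≤-Reasoning
    j : ℕ
    j = 4 + a * suc x
    factor≤2ʲ : a * suc (x * j) ≤ 2 ^ j
    factor≤2ʲ = begin
      a * suc (x * j)  ≤⟨ *-monoʳ-≤ a (+-monoˡ-≤ (x * j) (s≤s z≤n)) ⟩
      a * (j + x * j)  ≡⟨ identity a x j ⟩
      a * suc x * j  ≤⟨ *-monoˡ-≤ j (m≤n+m (a * suc x) 4) ⟩
      j * j  ≤⟨ square≤pow2 (a * suc x) ⟩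
      2 ^ j ∎
      where
      identity : ∀ a x j → a * (j + x * j) ≡ a * suc x * j
      identity = solve-∀

  -- Arithmetic of the rare-letter case, with v = 2K + 1, u = v + 1, c_b = c_a + d.

  -- If a is rare (c_a < K d), the single-draw weight B = uvn + u c_a − v c_b satisfies
  -- σB ≤ xn with x + 1 = σuv, i.e. B ≤ (x/(x + 1)) uvn: indeed σB + n ≤ σ(B + c_b) ≤ σuvn.
  rare-mass-bound : ∀ K σ ca d B n x → suc ca ≤ K * d →
    B + suc (K + K) * (ca + d) ≡ suc (suc (K + K)) * suc (K + K) * n + suc (suc (K + K)) * ca →
    n ≤ σ * (ca + d) → suc x ≡ σ * (suc (suc (K + K)) * suc (K + K)) → σ * B ≤ x * n
  rare-mass-bound K σ ca d B n x rare mass pigeon x+1 = +-cancelˡ-≤ n (σ * B) (x * n) (begin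
    n + σ * B  ≤⟨ +-monoˡ-≤ (σ * B) pigeon ⟩
    σ * (ca + d) + σ * B  ≡⟨ trans (+-comm (σ * (ca + d)) (σ * B)) (sym (*-distribˡ-+ σ B (ca + d))) ⟩
    σ * (B + (ca + d))  ≤⟨ *-monoʳ-≤ σ B+cb≤uvn ⟩
    σ * (u * v * n)  ≡⟨ trans (sym (*-assoc σ (u * v) n)) (cong (_* n) (sym x+1)) ⟩
    suc x * n ∎)
    where
    open ≤-Reasoning
    v u : ℕ
    v = suc (K + K)
    u = suc v
    -- u c_a + c_b + 2 ≤ v c_b, using 2 c_a + 2 ≤ 2Kd
    slack : u * ca + (ca + d) + 2 + 2 * ca ≤ v * (ca + d) + 2 * ca
    slack = begin
      u * ca + (ca + d) + 2 + 2 * ca  ≡⟨ identity₁ (u * ca) (ca + d) ca ⟩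
      u * ca + (ca + d) + 2 * suc ca  ≤⟨ +-monoʳ-≤ (u * ca + (ca + d)) (*-monoʳ-≤ 2 rare) ⟩
      u * ca + (ca + d) + 2 * (K * d)  ≡⟨ sym (identity₂ K ca d) ⟩
      v * (ca + d) + 2 * ca ∎
      where
      identity₁ : ∀ p q c → p + q + 2 + 2 * c ≡ p + q + 2 * suc c
      identity₁ = solve-∀
      identity₂ : ∀ K ca d → suc (K + K) * (ca + d) + 2 * ca ≡ suc (suc (K + K)) * ca + (ca + d) + 2 * (K * d)
      identity₂ = solve-∀
    B+cb≤uvn : B + (ca + d) ≤ u * v * n
    B+cb≤uvn = ≤-trans (m≤m+n (B + (ca + d)) 2) (+-cancelʳ-≤ (u * ca) _ _ (begin
      B + (ca + d) + 2 + u * ca  ≡⟨ identity B (ca + d) (u * ca) ⟩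
      B + (u * ca + (ca + d) + 2)  ≤⟨ +-monoʳ-≤ B (+-cancelʳ-≤ (2 * ca) _ _ slack) ⟩
      B + v * (ca + d)  ≡⟨ mass ⟩
      u * v * n + u * ca ∎))
      where
      identity : ∀ B q p → B + q + 2 + p ≡ B + (p + q + 2)
      identity = solve-∀

  -- Combining the tilting bound T (uv)^{k+1} ≤ (k + 1) u² c_a Bᵏ with σB ≤ xn, the choice of k
  -- and d ≤ n gives K · d · T ≤ c_a n^{k+1}.
  rare-letter-arith : ∀ K σ u v x k ca d T B n → .{{_ : NonZero σ}} → .{{_ : NonZero u}} → .{{_ : NonZero v}} →
    T * (u * v * (u * v) ^ k) ≤ suc k * (u * u * ca) * B ^ k →
    σ * B ≤ x * n →
    K * u * suc k * x ^ k ≤ suc x ^ k →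
    suc x ≡ σ * (u * v) →
    d ≤ n →
    K * (d * T) ≤ 1 * ca * (n * n ^ k)
  rare-letter-arith K σ u v x k ca d T B n tilting mass exponent x+1 d≤n =
    *-cancelʳ-≤ (K * (d * T)) (1 * ca * (n * n ^ k)) Q {{Q≢0}} (begin
      K * (d * T) * Q  ≡⟨ e₁ K d T u v P S ⟩
      K * d * S * (T * (u * v * P))  ≤⟨ *-mono-≤ (*-monoˡ-≤ S (*-monoʳ-≤ K d≤n)) tilting ⟩
      K * n * S * (suc k * (u * u * ca) * B ^ k)  ≡⟨ e₂ K n S (suc k) (u * u * ca) (B ^ k) ⟩
      K * n * suc k * (u * u * ca) * (S * B ^ k)  ≡⟨ cong (K * n * suc k * (u * u * ca) *_) (sym (^-distribʳ-* σ B k)) ⟩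
      K * n * suc k * (u * u * ca) * (σ * B) ^ k  ≤⟨ *-monoʳ-≤ (K * n * suc k * (u * u * ca)) (^-monoˡ-≤ k mass) ⟩
      K * n * suc k * (u * u * ca) * (x * n) ^ k  ≡⟨ cong (K * n * suc k * (u * u * ca) *_) (^-distribʳ-* x n k) ⟩
      K * n * suc k * (u * u * ca) * (x ^ k * n ^ k)  ≡⟨ e₃ K n (suc k) u ca (x ^ k) (n ^ k) ⟩
      K * u * suc k * x ^ k * (u * ca * n * n ^ k)  ≤⟨ *-monoˡ-≤ (u * ca * n * n ^ k) exponent ⟩
      suc x ^ k * (u * ca * n * n ^ k)  ≡⟨ cong (λ z → z ^ k * (u * ca * n * n ^ k)) x+1 ⟩
      (σ * (u * v)) ^ k * (u * ca * n * n ^ k)  ≡⟨ cong (_* (u * ca * n * n ^ k)) (^-distribʳ-* σ (u * v) k) ⟩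
      S * P * (u * ca * n * n ^ k)  ≤⟨ m≤m*n (S * P * (u * ca * n * n ^ k)) v ⟩
      S * P * (u * ca * n * n ^ k) * v  ≡⟨ e₄ S P u ca n (n ^ k) v ⟩
      1 * ca * (n * n ^ k) * Q ∎)
    where
    open ≤-Reasoning
    P S Q : ℕ
    P = (u * v) ^ k
    S = σ ^ k
    Q = u * v * P * S
    Q≢0 : NonZero Q
    Q≢0 = m*n≢0 (u * v * P) S {{m*n≢0 (u * v) P {{m*n≢0 u v}} {{m^n≢0 (u * v) k {{m*n≢0 u v}}}}}} {{m^n≢0 σ k}}
    e₁ : ∀ K d T u v P S → K * (d * T) * (u * v * P * S) ≡ K * d * S * (T * (u * v * P))
    e₁ = solve-∀
    e₂ : ∀ K n S r w Bk → K * n * S * (r * w * Bk) ≡ K * n * r * w * (S * Bk)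
    e₂ = solve-∀
    e₃ : ∀ K n r u ca Xk Nk → K * n * r * (u * u * ca) * (Xk * Nk) ≡ K * u * r * Xk * (u * ca * n * Nk)
    e₃ = solve-∀
    e₄ : ∀ S P u ca n Nk v → S * P * (u * ca * n * Nk) * v ≡ 1 * ca * (n * Nk) * (u * v * P * S)
    e₄ = solve-∀

  -- For a target K: the tilting parameter v = 2K + 1, the base x = σ u v − 1 and the
  -- exponent k; samples have size r = k + 1.
  tiltOf : ℕ → ℕ
  tiltOf K = suc (K + K)

  baseOf : ℕ → ℕ → ℕ
  baseOf σ K = pred (σ * (suc (tiltOf K) * tiltOf K))

  exponentOf : ℕ → ℕ → ℕ
  exponentOf σ K = exponentFor (K * suc (tiltOf K)) (baseOf σ K)

  module ColumnBound {σ m} {{_ : NonZero σ}} (col : Vec (Fin σ) (suc m)) (K : ℕ) where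
    open Column col
    v u x k : ℕ
    v = tiltOf K
    u = suc v
    x = baseOf σ K
    k = exponentOf σ K

    x+1 : suc x ≡ σ * (u * v)
    x+1 = suc-pred (σ * (u * v)) {{m*n≢0 σ (u * v)}}

    x≥1 : 1 ≤ x
    x≥1 = pred-mono-≤ (≤-trans (≤-trans {2} {u} (s≤s (s≤s z≤n)) (m≤m*n u v)) (m≤n*m (u * v) σ))

    rare-letter : ∀ a → ¬ a ≡ b → suc (c a) ≤ K * gap a → K * (gap a * wins (suc k) a) ≤ 1 * c a * n ^ suc k
    rare-letter a a≢b rare =
      rare-letter-arith K σ u v x k (c a) (gap a) (wins (suc k) a) B n tilted-wins mass-bound
        (exponential-wins (K * u) x x≥1) x+1 (≤-trans (m∸n≤m (c b) (c a)) cb≤n)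
      where
      open Tilting a b a≢b v using (beats-weight; module Moments; A-closed; B-closed)
      open Moments col using (B; moment; moment-closed)
      cb≤n : c b ≤ n
      cb≤n = ≤-trans (m≤n+m (c b) (cost col b)) (≤-reflexive (cost+occ col b))
      ca≤cb : c a ≤ c b
      ca≤cb = mode-max col a
      tilted-wins : wins (suc k) a * (u * v * (u * v) ^ k) ≤ suc k * (u * u * c a) * B ^ k
      tilted-wins = begin
        wins (suc k) a * (u * v) ^ suc k  ≡⟨ sym (∑-*ʳ ((u * v) ^ suc k) (λ idx → indicator (beats a b (sample idx))) (allTuples (suc k) n)) ⟩
        ∑ (λ idx → indicator (beats a b (sample idx)) * (u * v) ^ suc k) (allTuples (suc k) n)  ≤⟨ ∑-mono (λ idx → beats-weight (sample idx)) (allTuples (suc k) n) ⟩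
        moment (suc k)  ≡⟨ moment-closed k ⟩
        suc k * Moments.A col * B ^ k  ≡⟨ cong (λ z → suc k * z * B ^ k) (A-closed col) ⟩
        suc k * (u * u * c a) * B ^ k ∎
        where open ≤-Reasoning
      mass-bound : σ * B ≤ x * n
      mass-bound = rare-mass-bound K σ (c a) (gap a) B n x rare
        (trans (cong (λ z → B + v * z) (m+[n∸m]≡n ca≤cb)) (B-closed col))
        (subst (λ z → n ≤ σ * z) (sym (m+[n∸m]≡n ca≤cb)) (pigeonhole col)) x+1

    per-letter : ∀ a → K * (gap a * wins (suc k) a) ≤ differ a b * c a * n ^ suc k
    per-letter a with a ≟ b
    ... | yes refl = ≤-trans (≤-reflexive (trans (cong (λ z → K * (z * wins (suc k) b)) (n∸n≡0 (c b))) (*-zeroʳ K))) z≤n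
    ... | no a≢b with K * gap a ≤? c a
    ...   | yes frequent = begin
            K * (gap a * wins (suc k) a)  ≡⟨ sym (*-assoc K (gap a) _) ⟩
            K * gap a * wins (suc k) a  ≤⟨ *-mono-≤ frequent (wins≤ (suc k) a) ⟩
            c a * n ^ suc k  ≡⟨ cong (_* n ^ suc k) (sym (*-identityˡ (c a))) ⟩
            1 * c a * n ^ suc k ∎
            where open ≤-Reasoning
    ...   | no rare = rare-letter a a≢b (≰⇒> rare)

    column-bound : K * totalCost (suc k) ≤ suc K * n ^ suc k * cost col b
    column-bound = reduce-to-letters K k per-letter

  distT-empty : ∀ {σ m} (S : Vec (Str σ 0) m) (y : Str σ 0) → distT S y ≡ 0
  distT-empty [] [] = refl
  distT-empty ([] ∷ S) [] = distT-empty S []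

  distT-cons : ∀ {σ ℓ m} (S : Vec (Str σ (suc ℓ)) m) a y →
    distT S (a ∷ y) ≡ cost (map head S) a + distT (map tail S) y
  distT-cons [] a y = refl
  distT-cons ((h ∷ t) ∷ S) a y rewrite distT-cons S a y =
    interchange (differ h a) (ham t y) (cost (map head S) a) (distT (map tail S) y)
    where
    interchange : ∀ e H C D → e + H + (C + D) ≡ e + C + (H + D)
    interchange = solve-∀

  consensus-cons : ∀ {σ ℓ m} {{_ : NonZero σ}} (T : Vec (Str σ (suc ℓ)) m) →
    consensus T ≡ mode (map head T) ∷ consensus (map tail T)
  consensus-cons T = cong₂ _∷_ (cong mode (map-cong lookup-zero T))
    (tabulate-cong (λ i → cong mode (trans (map-cong (lookup-suc i) T) (map-∘ (λ t → lookup t i) tail T))))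
    where
    lookup-zero : ∀ {A : Set} {ℓ} (t : Vec A (suc ℓ)) → lookup t zero ≡ head t
    lookup-zero (x ∷ t) = refl
    lookup-suc : ∀ {A : Set} {ℓ} i (t : Vec A (suc ℓ)) → lookup t (suc i) ≡ lookup (tail t) i
    lookup-suc i (x ∷ t) = refl

  select-map : ∀ {A B : Set} {n r} (f : A → B) (S : Vec A n) (idx : Vec (Fin n) r) →
    map f (select S idx) ≡ select (map f S) idx
  select-map f S idx = trans (sym (map-∘ f (lookup S) idx)) (map-cong (λ i → sym (lookup-map i f S)) idx)

  -- n^r times the expected distance from S to the consensus of a sample of size r
  totalDist : ∀ {σ ℓ m} {{_ : NonZero σ}} → ℕ → Vec (Str σ ℓ) (suc m) → ℕ
  totalDist {m = m} r S = ∑ (λ idx → distT S (consensus (select S idx))) (allTuples r (suc m))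

  sampling-bound : ∀ {σ m} {{_ : NonZero σ}} (K ℓ : ℕ) (S : Vec (Str σ ℓ) (suc m)) →
    K * totalDist (suc (exponentOf σ K)) S ≤ suc K * suc m ^ suc (exponentOf σ K) * distT S (consensus S)
  sampling-bound {σ} {m} K zero S =
    ≤-trans (≤-reflexive (trans (cong (K *_) (∑-zero (λ idx → distT-empty S _) (allTuples r (suc m)))) (*-zeroʳ K))) z≤n
    where
    r : ℕ
    r = suc (exponentOf σ K)
  sampling-bound {σ} {m} K (suc ℓ) S = begin
    K * totalDist r S  ≡⟨ cong (K *_) (trans (∑-cong by-column (allTuples r (suc m))) (∑-+ _ _ (allTuples r (suc m)))) ⟩
    K * (Column.totalCost hd r + totalDist r tl)  ≡⟨ *-distribˡ-+ K _ _ ⟩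
    K * Column.totalCost hd r + K * totalDist r tl  ≤⟨ +-mono-≤ (ColumnBound.column-bound hd K) (sampling-bound K ℓ tl) ⟩
    suc K * N * cost hd (mode hd) + suc K * N * distT tl (consensus tl)  ≡⟨ sym (*-distribˡ-+ (suc K * N) _ _) ⟩
    suc K * N * (cost hd (mode hd) + distT tl (consensus tl))
      ≡⟨ cong (suc K * N *_) (sym (trans (cong (distT S) (consensus-cons S)) (distT-cons S (mode hd) (consensus tl)))) ⟩
    suc K * N * distT S (consensus S) ∎
    where
    open ≤-Reasoning
    r N : ℕ
    r = suc (exponentOf σ K)
    hd : Vec (Fin σ) (suc m)
    hd = map head S
    tl : Vec (Str σ ℓ) (suc m)
    tl = map tail S
    N = suc m ^ r
    by-column : ∀ idx → distT S (consensus (select S idx))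
                      ≡ cost hd (mode (select hd idx)) + distT tl (consensus (select tl idx))
    by-column idx = begin-equality
      distT S (consensus (select S idx))  ≡⟨ cong (distT S) (consensus-cons (select S idx)) ⟩
      distT S (mode (map head (select S idx)) ∷ consensus (map tail (select S idx)))  ≡⟨ distT-cons S _ _ ⟩
      cost hd (mode (map head (select S idx))) + distT tl (consensus (map tail (select S idx)))
        ≡⟨ cong₂ (λ p q → cost hd (mode p) + distT tl (consensus q)) (select-map head S idx) (select-map tail S idx) ⟩
      cost hd (mode (select hd idx)) + distT tl (consensus (select tl idx)) ∎

-- From the integer inequality to the rational statement
module ToRational where
  open import Data.Nat as ℕ using (ℕ; suc; NonZero)
  import Data.Nat.Properties as ℕ
  import Data.Nat.Tactic.RingSolver as ℕ-Solver
  open import Data.Integer as ℤ using (+_; +[1+_])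
  import Data.Integer.Properties as ℤ
  import Data.Integer.Tactic.RingSolver as ℤ-Solver
  open import Data.Rational.Unnormalised as ℚᵘ using (mkℚᵘ; *≤*; 1ℚᵘ)
  import Data.Rational.Unnormalised.Properties as ℚᵘ
  open import Data.Rational as ℚ using (ℚ; mkℚ; Positive; _/_; 1ℚ; toℚᵘ)
  import Data.Rational.Properties as ℚ
  open import Relation.Binary.PropositionalEquality

  unnormalised-bound : ∀ (E N' K' p d : ℕ) → suc K' ℕ.* E ℕ.≤ (suc K' ℕ.+ p) ℕ.* d ℕ.* suc N' →
    ℚᵘ._≤_ (mkℚᵘ (+ E) N') (ℚᵘ._*_ (ℚᵘ._+_ 1ℚᵘ (mkℚᵘ (+ p) K')) (mkℚᵘ (+ d) 0))
  unnormalised-bound E N' K' p d h = *≤* (subst₂ ℤ._≤_ (sym lhs) (sym rhs) (ℤ.+≤+ h))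
    where
    one-factors : ∀ K' → 1 ℕ.* suc K' ℕ.* 1 ≡ suc K'
    one-factors = ℕ-Solver.solve-∀
    lhs : + E ℤ.* + (1 ℕ.* suc K' ℕ.* 1) ≡ + (suc K' ℕ.* E)
    lhs = trans (cong (λ z → + E ℤ.* + z) (one-factors K')) (trans (sym (ℤ.pos-* E (suc K'))) (cong +_ (ℕ.*-comm E (suc K'))))
    drop-ones : ∀ X P D N → (+ 1 ℤ.* X ℤ.+ P ℤ.* + 1) ℤ.* D ℤ.* N ≡ (X ℤ.+ P) ℤ.* D ℤ.* N
    drop-ones = ℤ-Solver.solve-∀
    rhs : (+ 1 ℤ.* + suc K' ℤ.+ + p ℤ.* + 1) ℤ.* + d ℤ.* + suc N' ≡ + ((suc K' ℕ.+ p) ℕ.* d ℕ.* suc N')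
    rhs = trans (drop-ones (+ suc K') (+ p) (+ d) (+ suc N'))
      (sym (trans (ℤ.pos-* ((suc K' ℕ.+ p) ℕ.* d) (suc N'))
        (cong (ℤ._* + suc N') (trans (ℤ.pos-* (suc K' ℕ.+ p) d) (cong (ℤ._* + d) (ℤ.pos-+ (suc K') p))))))

  -- With K the denominator of ε > 0 (so ε ≥ 1/K):  K E ≤ (K + 1) N d  ⇒  E / N ≤ (1 + ε) d.
  rational-bound : ∀ (ε : ℚ) → Positive ε → (E N d : ℕ) → .{{_ : NonZero N}} →
    ℚ.↧ₙ ε ℕ.* E ℕ.≤ suc (ℚ.↧ₙ ε) ℕ.* N ℕ.* d →
    ℚ._≤_ ((+ E) / N) ((1ℚ ℚ.+ ε) ℚ.* ((+ d) / 1))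
  rational-bound ε@(mkℚ +[1+ p ] K' _) _ E (suc N') d h = ℚ.toℚᵘ-cancel-≤
    (ℚᵘ.≤-respˡ-≃ (ℚᵘ.≃-sym (ℚ.toℚᵘ-fromℚᵘ (mkℚᵘ (+ E) N')))
      (ℚᵘ.≤-respʳ-≃ (ℚᵘ.≃-sym rhs≃) (unnormalised-bound E N' K' (suc p) d h′)))
    where
    rhs≃ : toℚᵘ ((1ℚ ℚ.+ ε) ℚ.* ((+ d) / 1)) ℚᵘ.≃ ℚᵘ._*_ (ℚᵘ._+_ 1ℚᵘ (mkℚᵘ (+ suc p) K')) (mkℚᵘ (+ d) 0)
    rhs≃ = ℚᵘ.≃-trans (ℚ.toℚᵘ-homo-* (1ℚ ℚ.+ ε) ((+ d) / 1))
             (ℚᵘ.*-cong (ℚ.toℚᵘ-homo-+ 1ℚ ε) (ℚ.toℚᵘ-fromℚᵘ (mkℚᵘ (+ d) 0)))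
    reorder : ∀ K N d → suc K ℕ.* N ℕ.* d ≡ (1 ℕ.+ K) ℕ.* d ℕ.* N
    reorder = ℕ-Solver.solve-∀
    -- K + 1 ≤ K + (p + 1), since the numerator of ε is positive
    h′ : suc K' ℕ.* E ℕ.≤ (suc K' ℕ.+ suc p) ℕ.* d ℕ.* suc N'
    h′ = ℕ.≤-trans h (ℕ.≤-trans (ℕ.≤-reflexive (reorder (suc K') (suc N') d))
           (ℕ.*-monoˡ-≤ (suc N') (ℕ.*-monoˡ-≤ d (ℕ.≤-trans (ℕ.≤-reflexive (ℕ.+-comm 1 (suc K'))) (ℕ.+-monoʳ-≤ (suc K') (ℕ.s≤s ℕ.z≤n))))))

open import Data.Nat using (ℕ; suc; NonZero; _^_)
open import Data.Vec using (Vec)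
open import Data.Product using (∃; _×_; _,_)
open import Data.Integer using (+_)
open import Data.Rational using (ℚ; Positive; _≤_; _+_; _*_; _/_; 1ℚ; ↧ₙ_)
open import Data.Nat.Properties using (m^n≢0)
open Development using (exponentOf; sampling-bound)
open ToRational using (rational-bound)

-- With K the denominator of ε, samples of size r = exponentOf σ K + 1 suffice.
lemma1 : (ε : ℚ) → Positive ε → (σ : ℕ) → {{_ : NonZero σ}} →
    ∃ λ (r : ℕ) → NonZero r ×
    ((ℓ m : ℕ) → (S : Vec (Str σ ℓ) (suc m)) →
    expectedDist r S ≤ (1ℚ + ε) * ((+ distT S (consensus S)) / 1))
lemma1 ε ε>0 σ = r , _ , λ ℓ m S →
  rational-bound ε ε>0 _ (suc m ^ r) (distT S (consensus S)) {{m^n≢0 (suc m) r}}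
    (sampling-bound (↧ₙ ε) ℓ S)
  where
  r : ℕ
  r = suc (exponentOf σ (↧ₙ ε))
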